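{- Let $7 \le L \le 21$ and $N_L = L^2+10L+7$. Then the coefficient of $q^N$ in $H_{L,3,L}(q)$ is nonnegative for every integer $N \ge N_L$.
   Context: $(a;q)_n := (1-a)(1-aq)\cdots(1-aq^{n-1})$. For positive integers $L,s,k$, $H_{L,s,k}(q) := \frac{q^s(1-q^k)}{(q^s;q)_{L+1}} - \left(\frac{1}{(q^{s+1};q)_L}-1\right)$. -}

module Defs where

open import Data.Nat as ℕ using (ℕ; zero; suc; _∸_)
open import Data.Nat.Divisibility using (_∣?_)
open import Data.Integer using (ℤ; _+_; _*_; _-_; 0ℤ; 1ℤ)
open import Data.Bool using (if_then_else_)
open import Relation.Nullary using (does)

-- Formal power series in q with integer coefficients: n ↦ coefficient of q^n.
PS : Set
PS = ℕ → ℤ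

sumTo : ℕ → (ℕ → ℤ) → ℤ
sumTo zero    f = f zero
sumTo (suc n) f = sumTo n f + f (suc n)

_⊕_ : PS → PS → PS
(f ⊕ g) n = f n + g n

_⊖_ : PS → PS → PS
(f ⊖ g) n = f n - g n

_⊛_ : PS → PS → PS
(f ⊛ g) n = sumTo n (λ i → f i * g (n ∸ i))

qpow : ℕ → PS
qpow m n = if does (m ℕ.≟ n) then 1ℤ else 0ℤ

one : PS
one = qpow 0

-- 1 / (1 - q^(suc j)) = Σ_i q^((suc j) i), the formal inverse of 1 - q^(suc j)
geomInv : ℕ → PS
geomInv j n = if does (suc j ∣? n) then 1ℤ else 0ℤ

-- 1 / (q^(suc a); q)_m = ∏_{i<m} 1/(1 - q^(suc a + i))
invPoch : ℕ → ℕ → PS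
invPoch a zero    = one
invPoch a (suc m) = invPoch a m ⊛ geomInv (a ℕ.+ m)

-- H_{L,s,k}(q) = q^s (1 - q^k) / (q^s;q)_{L+1} - (1/(q^{s+1};q)_L - 1),
-- for positive integers s (written as suc s') and k.
H : ℕ → ℕ → ℕ → PS
H L (suc s') k =
  ((qpow (suc s') ⊛ (one ⊖ qpow k)) ⊛ invPoch s' (suc L))
    ⊖ (invPoch (suc s') L ⊖ one)
H L zero k = λ _ → 0ℤ   -- s must be positive; never used

{-# OPTIONS --safe #-}
-- Write L = k + 1 and G = ∏ 1/(1 - q^i) over 4 ≤ i ≤ L + 3, i ≠ L.  Cancelling 1 - q^L against
-- 1/(q³;q)_{L+1} gives H_{L,3,L} = 1 + Y with Y = q³G/(1 - q³) - G/(1 - q^L).  Expanding both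
-- geometric factors up to period 3L gives Y = N G/(1 - q^{3L}) for the polynomial
-- N = q³(1 + q³ + ⋯ + q^{3(L-1)}) - (1 + q^L + q^{2L}) of degree 3L.
-- If f is nonnegative in degrees ≥ b, then so is f/(1 - q^c), provided its c coefficients of degrees
-- b, …, b + c - 1 are: beyond them each coefficient of f/(1 - q^c) is a coefficient of f plus an
-- earlier one of f/(1 - q^c).  Starting from N (which vanishes beyond degree 3L) and dividing out the
-- factors of G/(1 - q^{3L}) one at a time, for each 7 ≤ L ≤ 21 these finitely many windows are checked
-- by computation, with b = 3L + 1 ≤ N_L.
module Submission where

open import Defs
open import Data.Nat using (ℕ; _≤_; _+_; _*_)
open import Data.Integer using (0ℤ) renaming (_≤_ to _≤ℤ_)
open import Data.Nat using (zero; suc; _∸_; _<_; _≤ᵇ_; _<?_; z≤n; s≤s)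
import Data.Nat.Properties as ℕP
open import Data.Nat.Divisibility using (_∣_; _∣?_; _∣0; ∣m+n∣m⇒∣n; ∣m∣n⇒∣m+n; ∣-refl; ∣⇒≤)
open import Data.Nat.Induction using (<-rec)
open import Data.Integer as ℤ using (ℤ; 1ℤ; _≤?_)
import Data.Integer.Properties as ℤP
open import Data.Integer.Tactic.RingSolver using (solve-∀)
open import Data.Bool using (Bool; true; false; if_then_else_; _∧_; T)
open import Data.Bool.Properties using (T-∧)
open import Data.List using (List; []; _∷_; _++_; _∷ʳ_; [_]; length; applyUpTo; applyDownFrom)
open import Data.List.Properties using (applyUpTo-∷ʳ; length-applyDownFrom; ≡-dec)
open import Data.List.Relation.Binary.Permutation.Propositional as ↭ using (_↭_; ↭-sym; ↭-trans)
open import Data.List.Relation.Binary.Permutation.Propositional.Properties using (∷↭∷ʳ; ++⁺ʳ)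
open import Data.List.Sort.InsertionSort.Base ℕP.≤-decTotalOrder using (sort)
open import Data.List.Sort.InsertionSort.Properties ℕP.≤-decTotalOrder using (sort-↭)
open import Data.Fin using (Fin; toℕ; fromℕ<)
open import Data.Fin.Properties using (all?; toℕ-fromℕ<)
open import Data.Product using (_×_; _,_)
open import Data.Sum using (inj₁; inj₂)
open import Function using (_∘_; Equivalence; mk⇔)
open import Relation.Nullary.Decidable
  using (Dec; yes; no; isYes; True; toWitness; _→-dec_; _×-dec_; T?; does-⇔; dec-true; dec-false)
open import Relation.Binary.PropositionalEquality hiding ([_])
open ≡-Reasoning

+-sub-cancelʳ : ∀ a b → (a ℤ.+ b) ℤ.- b ≡ a
+-sub-cancelʳ = solve-∀

sub-+-cancelʳ : ∀ a b → (a ℤ.- b) ℤ.+ b ≡ a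
sub-+-cancelʳ = solve-∀

sumTo-cong : ∀ n {f g : ℕ → ℤ} → (∀ i → i ≤ n → f i ≡ g i) → sumTo n f ≡ sumTo n g
sumTo-cong zero    f≡g = f≡g 0 z≤n
sumTo-cong (suc n) f≡g =
  cong₂ ℤ._+_ (sumTo-cong n (λ i i≤n → f≡g i (ℕP.m≤n⇒m≤1+n i≤n))) (f≡g (suc n) ℕP.≤-refl)

sumTo-zero : ∀ n → sumTo n (λ _ → 0ℤ) ≡ 0ℤ
sumTo-zero zero    = refl
sumTo-zero (suc n) = trans (ℤP.+-identityʳ _) (sumTo-zero n)

sumTo-+ : ∀ n f g → sumTo n (λ i → f i ℤ.+ g i) ≡ sumTo n f ℤ.+ sumTo n g
sumTo-+ zero    f g = refl
sumTo-+ (suc n) f g =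
  trans (cong (ℤ._+ (f (suc n) ℤ.+ g (suc n))) (sumTo-+ n f g))
        (interchange (sumTo n f) (sumTo n g) (f (suc n)) (g (suc n)))
  where
  interchange : ∀ a b c d → (a ℤ.+ b) ℤ.+ (c ℤ.+ d) ≡ (a ℤ.+ c) ℤ.+ (b ℤ.+ d)
  interchange = solve-∀

sumTo-*ˡ : ∀ n c f → sumTo n (λ i → c ℤ.* f i) ≡ c ℤ.* sumTo n f
sumTo-*ˡ zero    c f = refl
sumTo-*ˡ (suc n) c f =
  trans (cong (ℤ._+ (c ℤ.* f (suc n))) (sumTo-*ˡ n c f)) (sym (ℤP.*-distribˡ-+ c (sumTo n f) (f (suc n))))

sumTo-*ʳ : ∀ n c f → sumTo n (λ i → f i ℤ.* c) ≡ sumTo n f ℤ.* c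
sumTo-*ʳ zero    c f = refl
sumTo-*ʳ (suc n) c f =
  trans (cong (ℤ._+ (f (suc n) ℤ.* c)) (sumTo-*ʳ n c f)) (sym (ℤP.*-distribʳ-+ c (sumTo n f) (f (suc n))))

sumTo-suc : ∀ n f → sumTo (suc n) f ≡ f 0 ℤ.+ sumTo n (f ∘ suc)
sumTo-suc zero    f = refl
sumTo-suc (suc n) f =
  trans (cong (ℤ._+ f (suc (suc n))) (sumTo-suc n f)) (ℤP.+-assoc (f 0) (sumTo n (f ∘ suc)) (f (suc (suc n))))

sumTo-reverse : ∀ n f → sumTo n f ≡ sumTo n (λ i → f (n ∸ i))
sumTo-reverse zero    f = refl
sumTo-reverse (suc n) f = begin
  sumTo n f ℤ.+ f (suc n)                   ≡⟨ cong (ℤ._+ f (suc n)) (sumTo-reverse n f) ⟩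
  sumTo n (λ i → f (n ∸ i)) ℤ.+ f (suc n)   ≡⟨ ℤP.+-comm _ (f (suc n)) ⟩
  f (suc n) ℤ.+ sumTo n (λ i → f (n ∸ i))   ≡⟨ sym (sumTo-suc n (λ i → f (suc n ∸ i))) ⟩
  sumTo (suc n) (λ i → f (suc n ∸ i))       ∎

sumTo-triangle : ∀ n (F : ℕ → ℕ → ℤ) →
  sumTo n (λ i → sumTo i (F i)) ≡ sumTo n (λ j → sumTo (n ∸ j) (λ k → F (j + k) j))
sumTo-triangle zero    F = refl
sumTo-triangle (suc n) F = begin
  sumTo n (λ i → sumTo i (F i)) ℤ.+ (sumTo n (F (suc n)) ℤ.+ F (suc n) (suc n))
    ≡⟨ cong (ℤ._+ (sumTo n (F (suc n)) ℤ.+ F (suc n) (suc n))) (sumTo-triangle n F) ⟩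
  sumTo n column ℤ.+ (sumTo n (F (suc n)) ℤ.+ F (suc n) (suc n))
    ≡⟨ sym (ℤP.+-assoc (sumTo n column) _ _) ⟩
  (sumTo n column ℤ.+ sumTo n (F (suc n))) ℤ.+ F (suc n) (suc n)
    ≡⟨ cong₂ ℤ._+_ (sym (sumTo-+ n column (F (suc n)))) lastColumn ⟩
  sumTo n (λ j → column j ℤ.+ F (suc n) j) ℤ.+ sumTo (suc n ∸ suc n) (λ k → F (suc n + k) (suc n))
    ≡⟨ cong (ℤ._+ sumTo (suc n ∸ suc n) (λ k → F (suc n + k) (suc n))) (sumTo-cong n extendColumn) ⟩
  sumTo (suc n) (λ j → sumTo (suc n ∸ j) (λ k → F (j + k) j)) ∎
  where
  column : ℕ → ℤ
  column j = sumTo (n ∸ j) (λ k → F (j + k) j)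
  lastColumn : F (suc n) (suc n) ≡ sumTo (suc n ∸ suc n) (λ k → F (suc n + k) (suc n))
  lastColumn = trans (cong (λ m → F m (suc n)) (sym (ℕP.+-identityʳ (suc n))))
                     (cong (λ m → sumTo m (λ k → F (suc n + k) (suc n))) (sym (ℕP.n∸n≡0 n)))
  extendColumn : ∀ j → j ≤ n → column j ℤ.+ F (suc n) j ≡ sumTo (suc n ∸ j) (λ k → F (j + k) j)
  extendColumn j j≤n = begin
    column j ℤ.+ F (suc n) j
      ≡⟨ cong (λ m → column j ℤ.+ F m j) suc-n≡ ⟩
    sumTo (suc (n ∸ j)) (λ k → F (j + k) j)
      ≡⟨ cong (λ m → sumTo m (λ k → F (j + k) j)) (sym (ℕP.+-∸-assoc 1 j≤n)) ⟩
    sumTo (suc n ∸ j) (λ k → F (j + k) j) ∎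
    where
    suc-n≡ : suc n ≡ j + suc (n ∸ j)
    suc-n≡ = trans (cong suc (sym (ℕP.m+[n∸m]≡n j≤n))) (sym (ℕP.+-suc j (n ∸ j)))

⊛-congˡ : ∀ {f f′} g → f ≗ f′ → (f ⊛ g) ≗ (f′ ⊛ g)
⊛-congˡ g f≗f′ n = sumTo-cong n (λ i _ → cong (ℤ._* g (n ∸ i)) (f≗f′ i))

⊛-congʳ : ∀ f {g g′} → g ≗ g′ → (f ⊛ g) ≗ (f ⊛ g′)
⊛-congʳ f g≗g′ n = sumTo-cong n (λ i _ → cong (f i ℤ.*_) (g≗g′ (n ∸ i)))

⊛-comm : ∀ f g → (f ⊛ g) ≗ (g ⊛ f)
⊛-comm f g n = begin
  sumTo n (λ i → f i ℤ.* g (n ∸ i))               ≡⟨ sumTo-reverse n _ ⟩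
  sumTo n (λ i → f (n ∸ i) ℤ.* g (n ∸ (n ∸ i)))   ≡⟨ sumTo-cong n flip ⟩
  sumTo n (λ i → g i ℤ.* f (n ∸ i))               ∎
  where
  flip : ∀ i → i ≤ n → f (n ∸ i) ℤ.* g (n ∸ (n ∸ i)) ≡ g i ℤ.* f (n ∸ i)
  flip i i≤n = trans (cong (λ m → f (n ∸ i) ℤ.* g m) (ℕP.m∸[m∸n]≡n i≤n)) (ℤP.*-comm (f (n ∸ i)) (g i))

⊛-assoc : ∀ f g h → ((f ⊛ g) ⊛ h) ≗ (f ⊛ (g ⊛ h))
⊛-assoc f g h n = begin
  sumTo n (λ i → sumTo i (λ j → f j ℤ.* g (i ∸ j)) ℤ.* h (n ∸ i))
    ≡⟨ sumTo-cong n (λ i _ → sym (sumTo-*ʳ i (h (n ∸ i)) (λ j → f j ℤ.* g (i ∸ j)))) ⟩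
  sumTo n (λ i → sumTo i (λ j → f j ℤ.* g (i ∸ j) ℤ.* h (n ∸ i)))
    ≡⟨ sumTo-triangle n (λ i j → f j ℤ.* g (i ∸ j) ℤ.* h (n ∸ i)) ⟩
  sumTo n (λ j → sumTo (n ∸ j) (λ k → f j ℤ.* g (j + k ∸ j) ℤ.* h (n ∸ (j + k))))
    ≡⟨ sumTo-cong n (λ j _ → trans (sumTo-cong (n ∸ j) (λ k _ → reindex j k))
                                   (sumTo-*ˡ (n ∸ j) (f j) (λ k → g k ℤ.* h (n ∸ j ∸ k)))) ⟩
  sumTo n (λ j → f j ℤ.* sumTo (n ∸ j) (λ k → g k ℤ.* h (n ∸ j ∸ k))) ∎
  where
  reindex : ∀ j k → f j ℤ.* g (j + k ∸ j) ℤ.* h (n ∸ (j + k)) ≡ f j ℤ.* (g k ℤ.* h (n ∸ j ∸ k))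
  reindex j k = trans (cong₂ (λ a b → f j ℤ.* g a ℤ.* h b) (ℕP.m+n∸m≡n j k) (sym (ℕP.∸-+-assoc n j k)))
                      (ℤP.*-assoc (f j) (g k) (h (n ∸ j ∸ k)))

⊛-distribˡ-⊕ : ∀ f g h → (f ⊛ (g ⊕ h)) ≗ ((f ⊛ g) ⊕ (f ⊛ h))
⊛-distribˡ-⊕ f g h n = trans (sumTo-cong n (λ i _ → ℤP.*-distribˡ-+ (f i) _ _)) (sumTo-+ n _ _)

⊛-distribʳ-⊕ : ∀ f g h → ((f ⊕ g) ⊛ h) ≗ ((f ⊛ h) ⊕ (g ⊛ h))
⊛-distribʳ-⊕ f g h n = trans (sumTo-cong n (λ i _ → ℤP.*-distribʳ-+ (h (n ∸ i)) (f i) _)) (sumTo-+ n _ _)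

⊛-distribʳ-⊖ : ∀ f g h → ((f ⊖ g) ⊛ h) ≗ ((f ⊛ h) ⊖ (g ⊛ h))
⊛-distribʳ-⊖ f g h n = begin
  ((f ⊖ g) ⊛ h) n
    ≡⟨ sym (+-sub-cancelʳ (((f ⊖ g) ⊛ h) n) ((g ⊛ h) n)) ⟩
  (((f ⊖ g) ⊛ h) n ℤ.+ (g ⊛ h) n) ℤ.- (g ⊛ h) n
    ≡⟨ cong (ℤ._- (g ⊛ h) n) (sym (⊛-distribʳ-⊕ (f ⊖ g) g h n)) ⟩
  (((f ⊖ g) ⊕ g) ⊛ h) n ℤ.- (g ⊛ h) n
    ≡⟨ cong (ℤ._- (g ⊛ h) n) (⊛-congˡ h (λ i → sub-+-cancelʳ (f i) (g i)) n) ⟩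
  (f ⊛ h) n ℤ.- (g ⊛ h) n ∎

⊛-identityˡ : ∀ f → (one ⊛ f) ≗ f
⊛-identityˡ f zero    = ℤP.*-identityˡ (f 0)
⊛-identityˡ f (suc n) = begin
  (one ⊛ f) (suc n)                         ≡⟨ sumTo-suc n _ ⟩
  1ℤ ℤ.* f (suc n) ℤ.+ sumTo n (λ _ → 0ℤ)   ≡⟨ cong₂ ℤ._+_ (ℤP.*-identityˡ (f (suc n))) (sumTo-zero n) ⟩
  f (suc n) ℤ.+ 0ℤ                          ≡⟨ ℤP.+-identityʳ (f (suc n)) ⟩
  f (suc n)                                 ∎

⊛-identityʳ : ∀ f → (f ⊛ one) ≗ f
⊛-identityʳ f n = trans (⊛-comm f one n) (⊛-identityˡ f n)

shift : ℕ → PS → PS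
shift zero    f n       = f n
shift (suc m) f zero    = 0ℤ
shift (suc m) f (suc n) = shift m f n

shift-≥ : ∀ m n f → m ≤ n → shift m f n ≡ f (n ∸ m)
shift-≥ zero    n       f _         = refl
shift-≥ (suc m) (suc n) f (s≤s m≤n) = shift-≥ m n f m≤n

shift-< : ∀ m n f → n < m → shift m f n ≡ 0ℤ
shift-< (suc m) zero    f _         = refl
shift-< (suc m) (suc n) f (s≤s n<m) = shift-< m n f n<m

shift-cong : ∀ m {f g} → f ≗ g → shift m f ≗ shift m g
shift-cong zero    f≗g n       = f≗g n
shift-cong (suc m) f≗g zero    = refl
shift-cong (suc m) f≗g (suc n) = shift-cong m f≗g n

shift-⊕ : ∀ m f g → shift m (f ⊕ g) ≗ (shift m f ⊕ shift m g)
shift-⊕ zero    f g n       = refl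
shift-⊕ (suc m) f g zero    = refl
shift-⊕ (suc m) f g (suc n) = shift-⊕ m f g n

shift-⊖ : ∀ m f g → shift m (f ⊖ g) ≗ (shift m f ⊖ shift m g)
shift-⊖ zero    f g n       = refl
shift-⊖ (suc m) f g zero    = refl
shift-⊖ (suc m) f g (suc n) = shift-⊖ m f g n

shift-shift : ∀ a b f → shift a (shift b f) ≗ shift (a + b) f
shift-shift zero    b f n       = refl
shift-shift (suc a) b f zero    = refl
shift-shift (suc a) b f (suc n) = shift-shift a b f n

shift-comm : ∀ a b f → shift a (shift b f) ≗ shift b (shift a f)
shift-comm a b f n = begin
  shift a (shift b f) n   ≡⟨ shift-shift a b f n ⟩
  shift (a + b) f n       ≡⟨ cong (λ m → shift m f n) (ℕP.+-comm a b) ⟩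
  shift (b + a) f n       ≡⟨ sym (shift-shift b a f n) ⟩
  shift b (shift a f) n   ∎

shift-zero : ∀ m → shift m (λ _ → 0ℤ) ≗ (λ _ → 0ℤ)
shift-zero zero    n       = refl
shift-zero (suc m) zero    = refl
shift-zero (suc m) (suc n) = shift-zero m n

shift-⊛ : ∀ m g f → (shift m g ⊛ f) ≗ shift m (g ⊛ f)
shift-⊛ zero    g f n       = refl
shift-⊛ (suc m) g f zero    = refl
shift-⊛ (suc m) g f (suc n) = trans (sumTo-suc n _) (trans (ℤP.+-identityˡ _) (shift-⊛ m g f n))

⊛-shift : ∀ m f g → (f ⊛ shift m g) ≗ shift m (f ⊛ g)
⊛-shift m f g n = begin
  (f ⊛ shift m g) n   ≡⟨ ⊛-comm f (shift m g) n ⟩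
  (shift m g ⊛ f) n   ≡⟨ shift-⊛ m g f n ⟩
  shift m (g ⊛ f) n   ≡⟨ shift-cong m (⊛-comm g f) n ⟩
  shift m (f ⊛ g) n   ∎

qpow≗shift-one : ∀ m → qpow m ≗ shift m one
qpow≗shift-one zero    n       = refl
qpow≗shift-one (suc m) zero    = refl
qpow≗shift-one (suc m) (suc n) = qpow≗shift-one m n

qpow-⊛ : ∀ m f → (qpow m ⊛ f) ≗ shift m f
qpow-⊛ m f n = begin
  (qpow m ⊛ f) n        ≡⟨ ⊛-congˡ f (qpow≗shift-one m) n ⟩
  (shift m one ⊛ f) n   ≡⟨ shift-⊛ m one f n ⟩
  shift m (one ⊛ f) n   ≡⟨ shift-cong m (⊛-identityˡ f) n ⟩
  shift m f n           ∎

qpow-≢ : ∀ {m n} → m ≢ n → qpow m n ≡ 0ℤ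
qpow-≢ {m} {n} m≢n = cong (if_then 1ℤ else 0ℤ) (dec-false (m ℕP.≟ n) m≢n)

geomInv-step : ∀ j m → j ≤ m → geomInv j (suc m) ≡ geomInv j (m ∸ j)
geomInv-step j m j≤m =
  cong (if_then 1ℤ else 0ℤ) (does-⇔ (mk⇔ to from) (suc j ∣? suc m) (suc j ∣? (m ∸ j)))
  where
  split : suc m ≡ suc j + (m ∸ j)
  split = cong suc (sym (ℕP.m+[n∸m]≡n j≤m))
  to : suc j ∣ suc m → suc j ∣ m ∸ j
  to d = ∣m+n∣m⇒∣n (subst (suc j ∣_) split d) ∣-refl
  from : suc j ∣ m ∸ j → suc j ∣ suc m
  from d = subst (suc j ∣_) (sym split) (∣m∣n⇒∣m+n ∣-refl d)

geomInv-below : ∀ j m → m < j → geomInv j (suc m) ≡ 0ℤ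
geomInv-below j m m<j =
  cong (if_then 1ℤ else 0ℤ) (dec-false (suc j ∣? suc m) (λ d → ℕP.<⇒≱ m<j (ℕP.≤-pred (∣⇒≤ d))))

geomInv-unfold : ∀ j → geomInv j ≗ (one ⊕ shift (suc j) (geomInv j))
geomInv-unfold j zero    = cong (if_then 1ℤ else 0ℤ) (dec-true (suc j ∣? 0) (suc j ∣0))
geomInv-unfold j (suc m) with ℕP.≤-<-connex j m
... | inj₁ j≤m = trans (geomInv-step j m j≤m) (trans (sym (shift-≥ j m (geomInv j) j≤m)) (sym (ℤP.+-identityˡ _)))
... | inj₂ m<j = trans (geomInv-below j m m<j) (trans (sym (shift-< j m (geomInv j) m<j)) (sym (ℤP.+-identityˡ _)))

⊛-geomInv-unfold : ∀ f j → (f ⊛ geomInv j) ≗ (f ⊕ shift (suc j) (f ⊛ geomInv j))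
⊛-geomInv-unfold f j n = begin
  (f ⊛ geomInv j) n
    ≡⟨ ⊛-congʳ f (geomInv-unfold j) n ⟩
  (f ⊛ (one ⊕ shift (suc j) (geomInv j))) n
    ≡⟨ ⊛-distribˡ-⊕ f one (shift (suc j) (geomInv j)) n ⟩
  (f ⊛ one) n ℤ.+ (f ⊛ shift (suc j) (geomInv j)) n
    ≡⟨ cong₂ ℤ._+_ (⊛-identityʳ f n) (⊛-shift (suc j) f (geomInv j) n) ⟩
  f n ℤ.+ shift (suc j) (f ⊛ geomInv j) n ∎

one⊖qpow-⊛ : ∀ c f → ((one ⊖ qpow c) ⊛ f) ≗ (f ⊖ shift c f)
one⊖qpow-⊛ c f n = trans (⊛-distribʳ-⊖ one (qpow c) f n) (cong₂ ℤ._-_ (⊛-identityˡ f n) (qpow-⊛ c f n))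

geomInv-cancel : ∀ j f → ((one ⊖ qpow (suc j)) ⊛ (f ⊛ geomInv j)) ≗ f
geomInv-cancel j f n = begin
  ((one ⊖ qpow (suc j)) ⊛ F) n
    ≡⟨ one⊖qpow-⊛ (suc j) F n ⟩
  F n ℤ.- shift (suc j) F n
    ≡⟨ cong (ℤ._- shift (suc j) F n) (⊛-geomInv-unfold f j n) ⟩
  (f n ℤ.+ shift (suc j) F n) ℤ.- shift (suc j) F n
    ≡⟨ +-sub-cancelʳ (f n) (shift (suc j) F n) ⟩
  f n ∎
  where
  F = f ⊛ geomInv j

geomInv-unique : ∀ j {F g} → (∀ n → F n ≡ g n ℤ.+ shift (suc j) F n) → F ≗ (g ⊛ geomInv j)
geomInv-unique j {F} {g} rec n = begin
  F n                                          ≡⟨ sym (geomInv-cancel j F n) ⟩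
  ((one ⊖ qpow (suc j)) ⊛ (F ⊛ geomInv j)) n   ≡⟨ sym (⊛-assoc (one ⊖ qpow (suc j)) F (geomInv j) n) ⟩
  (((one ⊖ qpow (suc j)) ⊛ F) ⊛ geomInv j) n   ≡⟨ ⊛-congˡ (geomInv j) cleared n ⟩
  (g ⊛ geomInv j) n                            ∎
  where
  cleared : ((one ⊖ qpow (suc j)) ⊛ F) ≗ g
  cleared m = trans (one⊖qpow-⊛ (suc j) F m)
                    (trans (cong (ℤ._- shift (suc j) F m) (rec m)) (+-sub-cancelʳ (g m) (shift (suc j) F m)))

sumSeries : ℕ → (ℕ → PS) → PS
sumSeries zero    F n = 0ℤ
sumSeries (suc k) F   = sumSeries k F ⊕ F k

sumSeries-cong : ∀ k {F G : ℕ → PS} → (∀ t → F t ≗ G t) → sumSeries k F ≗ sumSeries k G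
sumSeries-cong zero    F≗G n = refl
sumSeries-cong (suc k) F≗G n = cong₂ ℤ._+_ (sumSeries-cong k F≗G n) (F≗G k n)

sumSeries-⊛ : ∀ k F g → (sumSeries k F ⊛ g) ≗ sumSeries k (λ t → F t ⊛ g)
sumSeries-⊛ zero    F g n = sumTo-zero n
sumSeries-⊛ (suc k) F g n =
  trans (⊛-distribʳ-⊕ (sumSeries k F) (F k) g n) (cong (ℤ._+ (F k ⊛ g) n) (sumSeries-⊛ k F g n))

shift-sumSeries : ∀ m k F → shift m (sumSeries k F) ≗ sumSeries k (λ t → shift m (F t))
shift-sumSeries m zero    F n = shift-zero m n
shift-sumSeries m (suc k) F n =
  trans (shift-⊕ m (sumSeries k F) (F k) n) (cong (ℤ._+ shift m (F k) n) (shift-sumSeries m k F n))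

sumSeries-vanish : ∀ k F n → (∀ t → t < k → F t n ≡ 0ℤ) → sumSeries k F n ≡ 0ℤ
sumSeries-vanish zero    F n _     = refl
sumSeries-vanish (suc k) F n F≡0 =
  cong₂ ℤ._+_ (sumSeries-vanish k F n (λ t t<k → F≡0 t (ℕP.m≤n⇒m≤1+n t<k))) (F≡0 k ℕP.≤-refl)

unroll : ∀ c {F g} → F ≗ (g ⊕ shift c F) →
         ∀ k → F ≗ (sumSeries k (λ t → shift (t * c) g) ⊕ shift (k * c) F)
unroll c {F} {g} rec zero    n = sym (ℤP.+-identityˡ (F n))
unroll c {F} {g} rec (suc k) n = begin
  F n
    ≡⟨ unroll c rec k n ⟩
  S ℤ.+ shift (k * c) F n
    ≡⟨ cong (λ x → S ℤ.+ x) (shift-cong (k * c) rec n) ⟩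
  S ℤ.+ shift (k * c) (g ⊕ shift c F) n
    ≡⟨ cong (λ x → S ℤ.+ x) (shift-⊕ (k * c) g (shift c F) n) ⟩
  S ℤ.+ (shift (k * c) g n ℤ.+ shift (k * c) (shift c F) n)
    ≡⟨ cong (λ x → S ℤ.+ (shift (k * c) g n ℤ.+ x)) shift-kc-c ⟩
  S ℤ.+ (shift (k * c) g n ℤ.+ shift (suc k * c) F n)
    ≡⟨ sym (ℤP.+-assoc S _ _) ⟩
  (S ℤ.+ shift (k * c) g n) ℤ.+ shift (suc k * c) F n ∎
  where
  S = sumSeries k (λ t → shift (t * c) g) n
  shift-kc-c : shift (k * c) (shift c F) n ≡ shift (suc k * c) F n
  shift-kc-c = trans (shift-shift (k * c) c F n) (cong (λ m → shift m F n) (ℕP.+-comm (k * c) c))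

⊛-swapʳ : ∀ f g h → ((f ⊛ g) ⊛ h) ≗ ((f ⊛ h) ⊛ g)
⊛-swapʳ f g h n = begin
  ((f ⊛ g) ⊛ h) n   ≡⟨ ⊛-assoc f g h n ⟩
  (f ⊛ (g ⊛ h)) n   ≡⟨ ⊛-congʳ f (⊛-comm g h) n ⟩
  (f ⊛ (h ⊛ g)) n   ≡⟨ sym (⊛-assoc f h g n) ⟩
  ((f ⊛ h) ⊛ g) n   ∎

divs : List ℕ → PS → PS
divs []       f = f
divs (j ∷ js) f = divs js (f ⊛ geomInv j)

divs-cong : ∀ js {f g} → f ≗ g → divs js f ≗ divs js g
divs-cong []       f≗g = f≗g
divs-cong (j ∷ js) f≗g = divs-cong js (⊛-congˡ (geomInv j) f≗g)

divs-∷ʳ : ∀ xs x f → divs (xs ∷ʳ x) f ≡ divs xs f ⊛ geomInv x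
divs-∷ʳ []       x f = refl
divs-∷ʳ (y ∷ ys) x f = divs-∷ʳ ys x (f ⊛ geomInv y)

divs-↭ : ∀ {xs ys} → xs ↭ ys → ∀ f → divs xs f ≗ divs ys f
divs-↭ ↭.refl                            f n = refl
divs-↭ (↭.prep x p)                      f n = divs-↭ p (f ⊛ geomInv x) n
divs-↭ {ys = _ ∷ _ ∷ ys} (↭.swap x y p) f n =
  trans (divs-↭ p ((f ⊛ geomInv x) ⊛ geomInv y) n) (divs-cong ys (⊛-swapʳ f (geomInv x) (geomInv y)) n)
divs-↭ (↭.trans p q)                     f n = trans (divs-↭ p f n) (divs-↭ q f n)

divs-⊛ : ∀ js f g → divs js (f ⊛ g) ≗ (f ⊛ divs js g)
divs-⊛ []       f g n = refl
divs-⊛ (j ∷ js) f g n =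
  trans (divs-cong js (⊛-assoc f g (geomInv j)) n) (divs-⊛ js f (g ⊛ geomInv j) n)

invPoch≗divs : ∀ a m → invPoch a m ≗ divs (applyUpTo (a +_) m) one
invPoch≗divs a zero    n = refl
invPoch≗divs a (suc m) n = begin
  (invPoch a m ⊛ geomInv (a + m)) n
    ≡⟨ ⊛-congˡ (geomInv (a + m)) (invPoch≗divs a m) n ⟩
  (divs (applyUpTo (a +_) m) one ⊛ geomInv (a + m)) n
    ≡⟨ cong (λ F → F n) (sym (divs-∷ʳ (applyUpTo (a +_) m) (a + m) one)) ⟩
  divs (applyUpTo (a +_) m ∷ʳ (a + m)) one n
    ≡⟨ cong (λ js → divs js one n) (applyUpTo-∷ʳ (a +_) m) ⟩
  divs (applyUpTo (a +_) (suc m)) one n ∎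

sameSorted? : (xs ys : List ℕ) → Dec (sort xs ≡ sort ys)
sameSorted? xs ys = ≡-dec ℕP._≟_ (sort xs) (sort ys)

↭-by-sorting : ∀ xs ys → True (sameSorted? xs ys) → xs ↭ ys
↭-by-sorting xs ys sorted =
  ↭-trans (↭-sym (sort-↭ xs)) (subst (_↭ ys) (sym (toWitness {a? = sameSorted? xs ys} sorted)) (sort-↭ ys))

NonNegFrom : ℕ → PS → Set
NonNegFrom b f = ∀ n → b ≤ n → 0ℤ ≤ℤ f n

NonNegOn : ℕ → ℕ → PS → Set
NonNegOn b M f = ∀ n → b ≤ n → n < M → 0ℤ ≤ℤ f n

nonNegFrom-recurrence : ∀ {b M c} {f g : PS} → 0 < c → b + c ≤ M →
  (∀ n → f n ≡ g n ℤ.+ shift c f n) → NonNegFrom b g → NonNegOn b M f → NonNegFrom b f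
nonNegFrom-recurrence {b} {M} {c} {f} {g} 0<c b+c≤M rec g≥0 window = <-rec (λ n → b ≤ n → 0ℤ ≤ℤ f n) step
  where
  step : ∀ n → (∀ {m} → m < n → b ≤ m → 0ℤ ≤ℤ f m) → b ≤ n → 0ℤ ≤ℤ f n
  step n ih b≤n with n <? M
  ... | yes n<M = window n b≤n n<M
  ... | no  n≮M = subst (0ℤ ≤ℤ_) (sym (trans (rec n) (cong (λ x → g n ℤ.+ x) (shift-≥ c n f c≤n))))
                        (ℤP.+-mono-≤ (g≥0 n b≤n) (ih (ℕP.∸-monoʳ-< 0<c c≤n) (ℕP.m+n≤o⇒m≤o∸n b b+c≤n)))
    where
    b+c≤n : b + c ≤ n
    b+c≤n = ℕP.≤-trans b+c≤M (ℕP.≮⇒≥ n≮M)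
    c≤n : c ≤ n
    c≤n = ℕP.≤-trans (ℕP.m≤n+m c b) b+c≤n

atOrZero : ℕ → List ℤ → ℤ
atOrZero _       []       = 0ℤ
atOrZero zero    (x ∷ _)  = x
atOrZero (suc j) (_ ∷ xs) = atOrZero j xs

-- Tables are reversed prefixes applyDownFrom f M = f (M-1) ∷ ⋯ ∷ f 0 ∷ [], so lookups reach backwards.
atOrZero-applyDownFrom : ∀ j f n → atOrZero j (applyDownFrom f n) ≡ shift (suc j) f n
atOrZero-applyDownFrom j       f zero    = refl
atOrZero-applyDownFrom zero    f (suc n) = refl
atOrZero-applyDownFrom (suc j) f (suc n) = atOrZero-applyDownFrom j f n

divideTable : ℕ → List ℤ → List ℤ
divideTable j []       = []
divideTable j (x ∷ xs) = (x ℤ.+ atOrZero j (divideTable j xs)) ∷ divideTable j xs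

divideTable-applyDownFrom : ∀ j f n → divideTable j (applyDownFrom f n) ≡ applyDownFrom (f ⊛ geomInv j) n
divideTable-applyDownFrom j f zero    = refl
divideTable-applyDownFrom j f (suc n) rewrite divideTable-applyDownFrom j f n =
  cong (_∷ applyDownFrom (f ⊛ geomInv j) n)
       (trans (cong (λ x → f n ℤ.+ x) (atOrZero-applyDownFrom j (f ⊛ geomInv j) n)) (sym (⊛-geomInv-unfold f j n)))

nonNegAbove : ℕ → List ℤ → Bool
nonNegAbove b []       = true
nonNegAbove b (x ∷ xs) = (if b ≤ᵇ length xs then isYes (0ℤ ≤? x) else true) ∧ nonNegAbove b xs

nonNegAbove-sound : ∀ b M f → T (nonNegAbove b (applyDownFrom f M)) → NonNegOn b M f
nonNegAbove-sound b (suc M) f ok n b≤n n<1+M with Equivalence.to T-∧ ok | ℕP.m≤n⇒m<n∨m≡n (ℕP.≤-pred n<1+M)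
... | _    , rest | inj₁ n<M = nonNegAbove-sound b M f rest n b≤n n<M
... | head , _    | inj₂ refl = toWitness {a? = 0ℤ ≤? f n} (guarded inWindow head)
  where
  inWindow : T (b ≤ᵇ length (applyDownFrom f n))
  inWindow = subst (T ∘ (b ≤ᵇ_)) (sym (length-applyDownFrom f n)) (ℕP.≤⇒≤ᵇ b≤n)
  guarded : ∀ {c x} → T c → T (if c then x else true) → T x
  guarded {true} _ t = t

stagesNonNeg : ℕ → ℕ → List ℕ → List ℤ → Bool
stagesNonNeg b M []       t = true
stagesNonNeg b M (j ∷ js) t =
  (b + suc j ≤ᵇ M) ∧ (nonNegAbove b (divideTable j t) ∧ stagesNonNeg b M js (divideTable j t))

stagesNonNeg-sound : ∀ b M js f → T (stagesNonNeg b M js (applyDownFrom f M)) →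
                     NonNegFrom b f → NonNegFrom b (divs js f)
stagesNonNeg-sound b M []       f _  f≥0 = f≥0
stagesNonNeg-sound b M (j ∷ js) f ok f≥0 rewrite divideTable-applyDownFrom j f M
  with Equivalence.to T-∧ ok
... | fits , rest with Equivalence.to T-∧ rest
...   | window , later =
  stagesNonNeg-sound b M js (f ⊛ geomInv j) later
    (nonNegFrom-recurrence (s≤s z≤n) (ℕP.≤ᵇ⇒≤ (b + suc j) M fits) (⊛-geomInv-unfold f j) f≥0
                           (nonNegAbove-sound b M (f ⊛ geomInv j) window))

numerator : ℕ → PS
numerator L = sumSeries L (λ t → qpow (3 + t * 3)) ⊖ sumSeries 3 (λ t → qpow (t * L))

module Reduction (k : ℕ) (order : List ℕ) (perm : applyUpTo (3 +_) (suc k) ↭ order ∷ʳ k) where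

  L : ℕ
  L = suc k

  G R Q Y : PS
  G = divs order one
  R = G ⊛ geomInv 2
  Q = G ⊛ geomInv k
  Y = shift 3 R ⊖ Q

  invPoch≗Q : invPoch 3 L ≗ Q
  invPoch≗Q n = begin
    invPoch 3 L n                    ≡⟨ invPoch≗divs 3 L n ⟩
    divs (applyUpTo (3 +_) L) one n  ≡⟨ divs-↭ perm one n ⟩
    divs (order ∷ʳ k) one n          ≡⟨ cong (λ F → F n) (divs-∷ʳ order k one) ⟩
    Q n                              ∎

  invPoch≗R⊛geomInv : invPoch 2 (suc L) ≗ (R ⊛ geomInv k)
  invPoch≗R⊛geomInv n = begin
    invPoch 2 (suc L) n
      ≡⟨ invPoch≗divs 2 (suc L) n ⟩
    divs (2 ∷ applyUpTo (3 +_) L) one n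
      ≡⟨ divs-↭ (↭-trans (∷↭∷ʳ 2 (applyUpTo (3 +_) L)) (++⁺ʳ [ 2 ] perm)) one n ⟩
    divs ((order ∷ʳ k) ∷ʳ 2) one n
      ≡⟨ cong (λ F → F n) (divs-∷ʳ (order ∷ʳ k) 2 one) ⟩
    (divs (order ∷ʳ k) one ⊛ geomInv 2) n
      ≡⟨ cong (λ F → (F ⊛ geomInv 2) n) (divs-∷ʳ order k one) ⟩
    (Q ⊛ geomInv 2) n
      ≡⟨ ⊛-swapʳ G (geomInv k) (geomInv 2) n ⟩
    (R ⊛ geomInv k) n ∎

  H≗Y+1 : H L 3 L ≗ (Y ⊕ one)
  H≗Y+1 N = begin
    ((qpow 3 ⊛ (one ⊖ qpow L)) ⊛ P) N ℤ.- (invPoch 3 L N ℤ.- one N)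
      ≡⟨ cong₂ ℤ._-_ leading (cong (ℤ._- one N) (invPoch≗Q N)) ⟩
    shift 3 R N ℤ.- (Q N ℤ.- one N)
      ≡⟨ sub-sub (shift 3 R N) (Q N) (one N) ⟩
    (shift 3 R N ℤ.- Q N) ℤ.+ one N ∎
    where
    P = invPoch 2 (suc L)
    sub-sub : ∀ a b c → a ℤ.- (b ℤ.- c) ≡ (a ℤ.- b) ℤ.+ c
    sub-sub = solve-∀
    leading : ((qpow 3 ⊛ (one ⊖ qpow L)) ⊛ P) N ≡ shift 3 R N
    leading = begin
      ((qpow 3 ⊛ (one ⊖ qpow L)) ⊛ P) N
        ≡⟨ ⊛-assoc (qpow 3) (one ⊖ qpow L) P N ⟩
      (qpow 3 ⊛ ((one ⊖ qpow L) ⊛ P)) N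
        ≡⟨ qpow-⊛ 3 ((one ⊖ qpow L) ⊛ P) N ⟩
      shift 3 ((one ⊖ qpow L) ⊛ P) N
        ≡⟨ shift-cong 3 (⊛-congʳ (one ⊖ qpow L) invPoch≗R⊛geomInv) N ⟩
      shift 3 ((one ⊖ qpow L) ⊛ (R ⊛ geomInv k)) N
        ≡⟨ shift-cong 3 (geomInv-cancel k R) N ⟩
      shift 3 R N ∎

  q³R-unrolled : shift 3 R ≗ (sumSeries L (λ t → shift (3 + t * 3) G) ⊕ shift (L * 3) (shift 3 R))
  q³R-unrolled n = begin
    shift 3 R n
      ≡⟨ shift-cong 3 (unroll 3 {g = G} (⊛-geomInv-unfold G 2) L) n ⟩
    shift 3 (sumSeries L (λ t → shift (t * 3) G) ⊕ shift (L * 3) R) n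
      ≡⟨ shift-⊕ 3 (sumSeries L (λ t → shift (t * 3) G)) (shift (L * 3) R) n ⟩
    shift 3 (sumSeries L (λ t → shift (t * 3) G)) n ℤ.+ shift 3 (shift (L * 3) R) n
      ≡⟨ cong₂ ℤ._+_ (trans (shift-sumSeries 3 L (λ t → shift (t * 3) G) n)
                            (sumSeries-cong L (λ t → shift-shift 3 (t * 3) G) n))
                     (shift-comm 3 (L * 3) R n) ⟩
    sumSeries L (λ t → shift (3 + t * 3) G) n ℤ.+ shift (L * 3) (shift 3 R) n ∎

  Q-unrolled : Q ≗ (sumSeries 3 (λ t → shift (t * L) G) ⊕ shift (L * 3) Q)
  Q-unrolled n = trans (unroll L {g = G} (⊛-geomInv-unfold G k) 3 n)
                       (cong (λ m → sumSeries 3 (λ t → shift (t * L) G) n ℤ.+ shift m Q n) (ℕP.*-comm 3 L))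

  numerator⊛G :
    (numerator L ⊛ G) ≗ (sumSeries L (λ t → shift (3 + t * 3) G) ⊖ sumSeries 3 (λ t → shift (t * L) G))
  numerator⊛G n =
    trans (⊛-distribʳ-⊖ (sumSeries L (λ t → qpow (3 + t * 3))) (sumSeries 3 (λ t → qpow (t * L))) G n)
          (cong₂ ℤ._-_ (trans (sumSeries-⊛ L (λ t → qpow (3 + t * 3)) G n)
                              (sumSeries-cong L (λ t → qpow-⊛ (3 + t * 3) G) n))
                       (trans (sumSeries-⊛ 3 (λ t → qpow (t * L)) G n)
                              (sumSeries-cong 3 (λ t → qpow-⊛ (t * L) G) n)))

  Y-recurrence : ∀ n → Y n ≡ (numerator L ⊛ G) n ℤ.+ shift (L * 3) Y n
  Y-recurrence n = begin
    shift 3 R n ℤ.- Q n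
      ≡⟨ cong₂ ℤ._-_ (q³R-unrolled n) (Q-unrolled n) ⟩
    (A ℤ.+ shift (L * 3) (shift 3 R) n) ℤ.- (C ℤ.+ shift (L * 3) Q n)
      ≡⟨ interchange A (shift (L * 3) (shift 3 R) n) C (shift (L * 3) Q n) ⟩
    (A ℤ.- C) ℤ.+ (shift (L * 3) (shift 3 R) n ℤ.- shift (L * 3) Q n)
      ≡⟨ cong₂ ℤ._+_ (sym (numerator⊛G n)) (sym (shift-⊖ (L * 3) (shift 3 R) Q n)) ⟩
    (numerator L ⊛ G) n ℤ.+ shift (L * 3) Y n ∎
    where
    A = sumSeries L (λ t → shift (3 + t * 3) G) n
    C = sumSeries 3 (λ t → shift (t * L) G) n
    interchange : ∀ a x c y → (a ℤ.+ x) ℤ.- (c ℤ.+ y) ≡ (a ℤ.- c) ℤ.+ (x ℤ.- y)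
    interchange = solve-∀

  Y≗divs : Y ≗ divs (order ∷ʳ (2 + k * 3)) (numerator L)
  Y≗divs n = begin
    Y n
      ≡⟨ geomInv-unique (2 + k * 3) {g = numerator L ⊛ G} Y-recurrence n ⟩
    ((numerator L ⊛ G) ⊛ geomInv (2 + k * 3)) n
      ≡⟨ ⊛-congˡ (geomInv (2 + k * 3)) divs-numerator n ⟩
    (divs order (numerator L) ⊛ geomInv (2 + k * 3)) n
      ≡⟨ cong (λ F → F n) (sym (divs-∷ʳ order (2 + k * 3) (numerator L))) ⟩
    divs (order ∷ʳ (2 + k * 3)) (numerator L) n ∎
    where
    divs-numerator : (numerator L ⊛ G) ≗ divs order (numerator L)
    divs-numerator m = trans (sym (divs-⊛ order (numerator L) one m))
                             (divs-cong order (⊛-identityʳ (numerator L)) m)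

numerator-vanish : ∀ L n → L * 3 < n → numerator L n ≡ 0ℤ
numerator-vanish L n 3L<n = cong₂ ℤ._-_
  (sumSeries-vanish L (λ t → qpow (3 + t * 3)) n (λ t t<L → qpow-≢ (below (ℕP.*-monoˡ-≤ 3 t<L))))
  (sumSeries-vanish 3 (λ t → qpow (t * L)) n (λ t t<3 → qpow-≢ (below (tL≤3L t<3))))
  where
  tL≤3L : ∀ {t} → t < 3 → t * L ≤ L * 3
  tL≤3L {t} t<3 = ℕP.≤-trans (ℕP.*-monoˡ-≤ L {t} {3} (ℕP.<⇒≤ t<3)) (ℕP.≤-reflexive (ℕP.*-comm 3 L))
  below : ∀ {m} → m ≤ L * 3 → m ≢ n
  below m≤3L = ℕP.<⇒≢ (ℕP.≤-<-trans m≤3L 3L<n)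

threshold : ℕ → ℕ
threshold L = suc (L * 3)

numerator-nonNeg : ∀ L → NonNegFrom (threshold L) (numerator L)
numerator-nonNeg L n 3L<n = ℤP.≤-reflexive (sym (numerator-vanish L n 3L<n))

-- Indices j of the factors 1/(1 - q^(j+1)) of 1/(q⁴;q)_L other than 1/(1 - q^L), in the order in which
-- they are divided out.  For L = 8, dividing numerator 8 by 1 - q⁴ first would leave negative
-- coefficients in all large degrees ≡ 0 (mod 4), so 1 - q⁵ goes first.
divisionOrder : ℕ → List ℕ
divisionOrder 8 = 4 ∷ 3 ∷ 5 ∷ 6 ∷ 8 ∷ 9 ∷ 10 ∷ []
divisionOrder L = applyUpTo (3 +_) (L ∸ 4) ++ applyUpTo (L +_) 3

Certificate : ℕ → Set
Certificate L =
  True (sameSorted? (applyUpTo (3 +_) L) (divisionOrder L ∷ʳ (L ∸ 1))) ×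
  T (stagesNonNeg (threshold L) (threshold L + L * 3) (divisionOrder L ∷ʳ (L * 3 ∸ 1))
                  (applyDownFrom (numerator L) (threshold L + L * 3)))

certificate? : ∀ L → Dec (Certificate L)
certificate? L = T? _ ×-dec T? _

H-nonNeg : ∀ k → Certificate (suc k) → NonNegFrom (threshold (suc k)) (H (suc k) 3 (suc k))
H-nonNeg k (sorted , stages) (suc n) b≤n =
  subst (0ℤ ≤ℤ_) (sym (trans (H≗Y+1 (suc n)) (ℤP.+-identityʳ (Y (suc n))))) (Y-nonNeg (suc n) b≤n)
  where
  open Reduction k (divisionOrder (suc k)) (↭-by-sorting _ _ sorted)
  Y-nonNeg : NonNegFrom (threshold (suc k)) Y
  Y-nonNeg m b≤m = subst (0ℤ ≤ℤ_) (sym (Y≗divs m))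
    (stagesNonNeg-sound _ _ (divisionOrder (suc k) ∷ʳ (2 + k * 3)) (numerator (suc k)) stages
                        (numerator-nonNeg (suc k)) m b≤m)

certified : ∀ L → 7 ≤ L → L ≤ 21 → Certificate L
certified L 7≤L L≤21 = subst Certificate (toℕ-fromℕ< (s≤s L≤21))
  (allCertified (fromℕ< (s≤s L≤21)) (subst (7 ≤_) (sym (toℕ-fromℕ< (s≤s L≤21))) 7≤L))
  where
  allCertified : ∀ (i : Fin 22) → 7 ≤ toℕ i → Certificate (toℕ i)
  allCertified = toWitness {a? = all? (λ i → (7 ℕP.≤? toℕ i) →-dec certificate? (toℕ i))} _

threshold-≤ : ∀ L → threshold L ≤ L * L + 10 * L + 7
threshold-≤ L =
  ℕP.≤-<-trans (ℕP.≤-trans 3L≤10L (ℕP.m≤n+m (10 * L) (L * L))) (ℕP.m<m+n (L * L + 10 * L) (s≤s z≤n))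
  where
  3L≤10L : L * 3 ≤ 10 * L
  3L≤10L = ℕP.≤-trans (ℕP.≤-reflexive (ℕP.*-comm L 3)) (ℕP.*-monoˡ-≤ L {3} {10} (s≤s (s≤s (s≤s z≤n))))

lemma16 : (L : ℕ) → 7 ≤ L → L ≤ 21 →
    (N : ℕ) → L * L + 10 * L + 7 ≤ N → 0ℤ ≤ℤ H L 3 L N
lemma16 (suc k) 7≤L L≤21 N N≥NL =
  H-nonNeg k (certified (suc k) 7≤L L≤21) N (ℕP.≤-trans (threshold-≤ (suc k)) N≥NL)
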